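{- Let $G$ be a complete wheel with $n\geq6$ vertices and let $k\geq5$. Then $md_k^{NL}(G)=n-2$ if $n\geq k+4$, and $md_k^{NL}(G)=n-1$ if $n\leq k+3$.
   Context: The complete wheel on $n$ vertices has vertex set $V=C\cup\{h\}$ with $C=\{c_1,\dots,c_{n-1}\}$, edges $\{c_i,h\}$ and $\{c_i,c_{i+1}\}$ for $1\le i\le n-1$, indices modulo $n-1$. $d(x,y)$ denotes graph distance; $\tau$ separates distinct $u,v$ if $d(u,\tau)\neq d(v,\tau)$. $L\subseteq V$ is an NL-landmark set for parameter $k$ if every pair of distinct $u,v\in V\setminus L$ is separated by at least $k$ distinct vertices of $L$; $md_k^{NL}(G)$ is the minimum cardinality of such a set. -}

module Defs where

open import Data.Nat using (ℕ; zero; suc; _+_; _∸_; _≤_)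
open import Data.Fin using (Fin; zero; suc; toℕ)
open import Data.Fin.Subset using (Subset; _∈_; _∉_; _⊆_; ∣_∣)
open import Data.Product using (Σ; _×_; ∃)
open import Data.Sum using (_⊎_)
open import Data.Unit using (⊤)
open import Data.Empty using (⊥)
open import Relation.Binary.PropositionalEquality using (_≡_; _≢_)

-- Complete wheel on n = suc m vertices: vertex set Fin (suc m).
-- The hub h is `zero`; the rim vertex c_(i+1) is `suc i` for i : Fin m,
-- so the rim is the cycle c_1 … c_m of length m = n - 1.

CycSucc : (m : ℕ) → Fin m → Fin m → Set
CycSucc m i j = (toℕ j ≡ suc (toℕ i)) ⊎ ((suc (toℕ i) ≡ m) × (toℕ j ≡ 0))

WAdj : (m : ℕ) → Fin (suc m) → Fin (suc m) → Set
WAdj m zero    zero    = ⊥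
WAdj m zero    (suc j) = ⊤
WAdj m (suc i) zero    = ⊤
WAdj m (suc i) (suc j) = CycSucc m i j ⊎ CycSucc m j i

data Walk (m : ℕ) : Fin (suc m) → Fin (suc m) → ℕ → Set where
  here : ∀ {u} → Walk m u u 0
  step : ∀ {u w v ℓ} → WAdj m u w → Walk m w v ℓ → Walk m u v (suc ℓ)

IsDist : (m : ℕ) → Fin (suc m) → Fin (suc m) → ℕ → Set
IsDist m u v d = Walk m u v d × (∀ ℓ → Walk m u v ℓ → d ≤ ℓ)

Separates : (m : ℕ) → Fin (suc m) → Fin (suc m) → Fin (suc m) → Set
Separates m τ u v = ∀ a b → IsDist m u τ a → IsDist m v τ b → a ≢ b

IsNLLandmark : (m k : ℕ) → Subset (suc m) → Set
IsNLLandmark m k L =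
  ∀ u v → u ≢ v → u ∉ L → v ∉ L →
  Σ (Subset (suc m)) λ S → S ⊆ L × k ≤ ∣ S ∣ × (∀ {τ} → τ ∈ S → Separates m τ u v)

IsMdNL : (m k c : ℕ) → Set
IsMdNL m k c =
  (Σ (Subset (suc m)) λ L → IsNLLandmark m k L × ∣ L ∣ ≡ c) ×
  (∀ L → IsNLLandmark m k L → c ≤ ∣ L ∣)

module Submission where

-- The wheel has hub h and rim cycle c₁ … c_m, n = m + 1 vertices, and diameter 2.
-- Hence a vertex τ ∉ {u, v} separates u and v exactly when it is adjacent to one
-- of them and not to the other (the separation criterion below).  Consequently:
--  * two rim vertices are separated only by rim neighbours of one of them, i.e. by
--    at most 4 vertices; as k ≥ 5, an NL-landmark set misses at most one rim vertex;
--  * the hub and a rim vertex c are separated only by rim vertices other than c and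
--    its two neighbours, i.e. by at most n − 4 vertices; so if n ≤ k + 3 an
--    NL-landmark set cannot miss both the hub and a rim vertex.
-- Counting the vertices outside L gives |L| ≥ n − 2, and |L| ≥ n − 1 when n ≤ k + 3.
-- Conversely the rim is an NL-landmark set of size n − 1 (only the hub lies outside
-- it), and the rim without c₁ is one of size n − 2 once the n − 4 rim vertices far
-- from c₁, which all separate h from c₁, number at least k, i.e. once n ≥ k + 4.
-- The file proves, in order: counting facts for finite subsets, distances and the
-- separation criterion, the cycle structure of the rim, the two separator bounds,
-- the lower bounds, the two constructions, and the theorem.

open import Defs
open import Data.Nat using (ℕ; zero; suc; _+_; _∸_; _≤_; _<_; z≤n; s≤s; _<?_)
open import Data.Nat.Properties
  using (≤-antisym; ≤-trans; ≤-reflexive; ≤-pred; suc-injective; +-suc; +-comm; +-identityʳ;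
         +-monoˡ-≤; +-cancelˡ-≤; +-cancelʳ-≤; m≤m+n; m∸n≤m; ∸-monoˡ-≤; m∸n+n≡m;
         n≤1+n; 1+n≢n; 1+n≢0; n≮n; ≰⇒>)
  renaming (_≟_ to _≟ℕ_)
open import Data.Fin using (Fin; zero; suc; toℕ; fromℕ; fromℕ<; inject₁)
open import Data.Fin.Properties
  using (toℕ-injective; toℕ<n; toℕ-fromℕ; toℕ-fromℕ<; toℕ-inject₁; any?)
  renaming (_≟_ to _≟ᶠ_; suc-injective to Fin-suc-injective)
open import Data.Fin.Subset
  using (Subset; _∈_; _∉_; _⊆_; ∣_∣; _∪_; ⁅_⁆; ⋃; ∁; inside; outside) renaming (⊤ to Full)
open import Data.Fin.Subset.Properties
  using (∈⊤; ∣⊤∣≡n; ∣⊥∣≡0; ∣p∣≤n; ∣⁅x⁆∣≡1; x∈⁅x⁆; x∈⁅y⁆⇒x≡y; x∈p∪q⁺; x∈p∪q⁻; p⊆p∪q;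
         p⊆q⇒∣p∣≤∣q∣; p⊂q⇒∣p∣<∣q∣; ∣∁p∣≡n∸∣p∣; x∈∁p⇒x∉p; _∈?_)
open import Data.Vec.Base using (here; there; []; _∷_)
open import Data.List using (List; []; _∷_; length)
import Data.List as List
open import Data.List.Relation.Unary.Any as Any using ()
open import Data.List.Relation.Unary.All as All using (All; []; _∷_)
open import Data.List.Relation.Unary.AllPairs using ([]; _∷_)
open import Data.List.Relation.Unary.Unique.Propositional using (Unique)
open import Data.List.Membership.Propositional using () renaming (_∈_ to _∈ˡ_)
open import Data.Product using (Σ; ∃; _×_; _,_; proj₁; proj₂)
open import Data.Sum using (_⊎_; inj₁; inj₂; [_,_])
open import Data.Unit using (tt)
open import Data.Empty using (⊥-elim)
open import Function using (_∘_)
open import Relation.Nullary using (¬_; Dec; yes; no; ¬?)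
open import Relation.Nullary.Decidable using (_⊎-dec_; _×-dec_)
open import Relation.Binary.PropositionalEquality
  using (_≡_; _≢_; refl; sym; trans; cong; subst)
open Data.Nat.Properties.≤-Reasoning

private
  variable
    m n k r : ℕ

-- Counting in finite subsets

listSet : List (Fin n) → Subset n
listSet xs = ⋃ (List.map ⁅_⁆ xs)

∈-listSet : ∀ {x : Fin n} {xs} → x ∈ˡ xs → x ∈ listSet xs
∈-listSet (Any.here refl) = x∈p∪q⁺ (inj₁ (x∈⁅x⁆ _))
∈-listSet (Any.there x∈xs) = x∈p∪q⁺ (inj₂ (∈-listSet x∈xs))

∣p∪q∣≤∣p∣+∣q∣ : (p q : Subset n) → ∣ p ∪ q ∣ ≤ ∣ p ∣ + ∣ q ∣
∣p∪q∣≤∣p∣+∣q∣ [] [] = z≤n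
∣p∪q∣≤∣p∣+∣q∣ (outside ∷ p) (outside ∷ q) = ∣p∪q∣≤∣p∣+∣q∣ p q
∣p∪q∣≤∣p∣+∣q∣ (inside ∷ p) (outside ∷ q) = s≤s (∣p∪q∣≤∣p∣+∣q∣ p q)
∣p∪q∣≤∣p∣+∣q∣ (outside ∷ p) (inside ∷ q) rewrite +-suc ∣ p ∣ ∣ q ∣ = s≤s (∣p∪q∣≤∣p∣+∣q∣ p q)
∣p∪q∣≤∣p∣+∣q∣ (inside ∷ p) (inside ∷ q) rewrite +-suc ∣ p ∣ ∣ q ∣ =
  s≤s (≤-trans (∣p∪q∣≤∣p∣+∣q∣ p q) (n≤1+n _))

∣listSet∣≤length : (xs : List (Fin n)) → ∣ listSet xs ∣ ≤ length xs
∣listSet∣≤length {n} [] = ≤-reflexive (∣⊥∣≡0 n)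
∣listSet∣≤length (x ∷ xs) = begin
  ∣ ⁅ x ⁆ ∪ listSet xs ∣         ≤⟨ ∣p∪q∣≤∣p∣+∣q∣ ⁅ x ⁆ (listSet xs) ⟩
  ∣ ⁅ x ⁆ ∣ + ∣ listSet xs ∣     ≡⟨ cong (_+ ∣ listSet xs ∣) (∣⁅x⁆∣≡1 x) ⟩
  suc ∣ listSet xs ∣             ≤⟨ s≤s (∣listSet∣≤length xs) ⟩
  suc (length xs)                ∎

⊆list⇒∣∣≤length : (S : Subset n) (xs : List (Fin n)) →
  (∀ {x} → x ∈ S → x ∈ˡ xs) → ∣ S ∣ ≤ length xs
⊆list⇒∣∣≤length S xs S⊆xs = ≤-trans (p⊆q⇒∣p∣≤∣q∣ (∈-listSet ∘ S⊆xs)) (∣listSet∣≤length xs)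

outside⊆list⇒bound : (L : Subset n) (xs : List (Fin n)) →
  (∀ {x} → x ∉ L → x ∈ˡ xs) → n ≤ length xs + ∣ L ∣
outside⊆list⇒bound {n} L xs outside⊆xs = begin
  n                      ≡⟨ sym (m∸n+n≡m (∣p∣≤n L)) ⟩
  (n ∸ ∣ L ∣) + ∣ L ∣    ≡⟨ cong (_+ ∣ L ∣) (sym (∣∁p∣≡n∸∣p∣ L)) ⟩
  ∣ ∁ L ∣ + ∣ L ∣        ≤⟨ +-monoˡ-≤ ∣ L ∣ (⊆list⇒∣∣≤length (∁ L) xs (outside⊆xs ∘ x∈∁p⇒x∉p)) ⟩
  length xs + ∣ L ∣      ∎

-- A set avoiding the distinct elements of xs has at most n − length xs elements:
-- adding them one at a time strictly increases the size each time.
avoiding-distinct : (S : Subset n) (xs : List (Fin n)) →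
  Unique xs → All (_∉ S) xs → ∣ S ∣ + length xs ≤ n
avoiding-distinct S [] [] [] = ≤-trans (≤-reflexive (+-identityʳ ∣ S ∣)) (∣p∣≤n S)
avoiding-distinct {n} S (x ∷ xs) (x≢xs ∷ unique) (x∉S ∷ xs∉S) = begin
  ∣ S ∣ + suc (length xs)     ≡⟨ +-suc ∣ S ∣ (length xs) ⟩
  suc ∣ S ∣ + length xs       ≤⟨ +-monoˡ-≤ (length xs) ∣S∣<∣S∪x∣ ⟩
  ∣ S ∪ ⁅ x ⁆ ∣ + length xs   ≤⟨ avoiding-distinct (S ∪ ⁅ x ⁆) xs unique xs∉S∪x ⟩
  n                           ∎
  where
  ∣S∣<∣S∪x∣ : ∣ S ∣ < ∣ S ∪ ⁅ x ⁆ ∣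
  ∣S∣<∣S∪x∣ = p⊂q⇒∣p∣<∣q∣ (p⊆p∪q ⁅ x ⁆ , x , x∈p∪q⁺ (inj₂ (x∈⁅x⁆ x)) , x∉S)
  xs∉S∪x : All (_∉ S ∪ ⁅ x ⁆) xs
  xs∉S∪x = All.zipWith
    (λ { (x≢y , y∉S) y∈S∪x → [ y∉S , x≢y ∘ sym ∘ x∈⁅y⁆⇒x≡y x ] (x∈p∪q⁻ S ⁅ x ⁆ y∈S∪x) })
    (x≢xs , xs∉S)

∉⇒≢ : {S : Subset n} {x y : Fin n} → x ∉ S → y ∈ S → x ≢ y
∉⇒≢ x∉S y∈S refl = x∉S y∈S

-- Distances in the wheel and the separation criterion

private
  variable
    u v τ : Fin (suc m)

walk-zero : Walk m u v 0 → u ≡ v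
walk-zero here = refl

walk-one : Walk m u v 1 → WAdj m u v
walk-one (step u~w here) = u~w

dist-unique : ∀ {a b} → IsDist m u v a → IsDist m u v b → a ≡ b
dist-unique (walk-a , least-a) (walk-b , least-b) = ≤-antisym (least-a _ walk-b) (least-b _ walk-a)

dist-adjacent : u ≢ v → WAdj m u v → IsDist m u v 1
dist-adjacent {m} {u} {v} u≢v u~v = step u~v here , least
  where
  least : ∀ ℓ → Walk m u v ℓ → 1 ≤ ℓ
  least zero w = ⊥-elim (u≢v (walk-zero w))
  least (suc ℓ) _ = s≤s z≤n

-- Distinct non-adjacent vertices both lie on the rim, and the hub joins them.
dist-nonadjacent : u ≢ v → ¬ WAdj m u v → IsDist m u v 2
dist-nonadjacent {u = zero} {v = zero} u≢v _ = ⊥-elim (u≢v refl)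
dist-nonadjacent {u = zero} {v = suc _} _ u≁v = ⊥-elim (u≁v tt)
dist-nonadjacent {u = suc _} {v = zero} _ u≁v = ⊥-elim (u≁v tt)
dist-nonadjacent {m} {u = suc i} {v = suc j} u≢v u≁v = step {w = zero} tt (step tt here) , least
  where
  least : ∀ ℓ → Walk m (suc i) (suc j) ℓ → 2 ≤ ℓ
  least zero w = ⊥-elim (u≢v (walk-zero w))
  least (suc zero) w = ⊥-elim (u≁v (walk-one w))
  least (suc (suc ℓ)) _ = s≤s (s≤s z≤n)

cycSucc? : (i j : Fin m) → Dec (CycSucc m i j)
cycSucc? {m} i j = (toℕ j ≟ℕ suc (toℕ i)) ⊎-dec ((suc (toℕ i) ≟ℕ m) ×-dec (toℕ j ≟ℕ 0))

adjacent? : (u v : Fin (suc m)) → Dec (WAdj m u v)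
adjacent? zero zero = no λ ()
adjacent? zero (suc _) = yes tt
adjacent? (suc _) zero = yes tt
adjacent? (suc i) (suc j) = cycSucc? i j ⊎-dec cycSucc? j i

AdjacentToOne : (m : ℕ) → Fin (suc m) → Fin (suc m) → Fin (suc m) → Set
AdjacentToOne m u v τ = (WAdj m u τ × ¬ WAdj m v τ) ⊎ (¬ WAdj m u τ × WAdj m v τ)

-- Separation criterion: as distances are 0, 1 or 2, a vertex τ ∉ {u, v} separates
-- u and v iff it is adjacent to exactly one of them.
separates⇒adjacentToOne : u ≢ τ → v ≢ τ → Separates m τ u v → AdjacentToOne m u v τ
separates⇒adjacentToOne {u = u} {τ} {v = v} u≢τ v≢τ sep with adjacent? u τ | adjacent? v τ
... | yes u~τ | yes v~τ = ⊥-elim (sep 1 1 (dist-adjacent u≢τ u~τ) (dist-adjacent v≢τ v~τ) refl)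
... | no u≁τ | no v≁τ = ⊥-elim (sep 2 2 (dist-nonadjacent u≢τ u≁τ) (dist-nonadjacent v≢τ v≁τ) refl)
... | yes u~τ | no v≁τ = inj₁ (u~τ , v≁τ)
... | no u≁τ | yes v~τ = inj₂ (u≁τ , v~τ)

adjacentToOne⇒separates : u ≢ τ → v ≢ τ → AdjacentToOne m u v τ → Separates m τ u v
adjacentToOne⇒separates u≢τ v≢τ (inj₁ (u~τ , v≁τ)) a b du dv a≡b
  with () ← trans (dist-unique (dist-adjacent u≢τ u~τ) du) (trans a≡b (dist-unique dv (dist-nonadjacent v≢τ v≁τ)))
adjacentToOne⇒separates u≢τ v≢τ (inj₂ (u≁τ , v~τ)) a b du dv a≡b
  with () ← trans (dist-unique (dist-nonadjacent u≢τ u≁τ) du) (trans a≡b (dist-unique dv (dist-adjacent v≢τ v~τ)))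

separates-sym : Separates m τ u v → Separates m τ v u
separates-sym sep a b dv du a≡b = sep b a du dv (sym a≡b)

-- The rim cycle: successors and predecessors

successor : (i : Fin m) → Σ (Fin m) (CycSucc m i)
successor {suc m} i with suc (toℕ i) <? suc m
... | yes i+1<m = fromℕ< i+1<m , inj₁ (toℕ-fromℕ< i+1<m)
... | no i+1≮m = zero , inj₂ (≤-antisym (toℕ<n i) (≤-pred (≰⇒> i+1≮m)) , refl)

predecessor : (i : Fin m) → Σ (Fin m) (λ p → CycSucc m p i)
predecessor {suc m} zero = fromℕ m , inj₂ (cong suc (toℕ-fromℕ m) , refl)
predecessor {suc m} (suc i) = inject₁ i , inj₁ (cong suc (sym (toℕ-inject₁ i)))

next prev : Fin m → Fin m
next i = proj₁ (successor i)
prev i = proj₁ (predecessor i)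

successor-unique : {i s s′ : Fin m} → CycSucc m i s → CycSucc m i s′ → s ≡ s′
successor-unique (inj₁ s≡) (inj₁ s′≡) = toℕ-injective (trans s≡ (sym s′≡))
successor-unique {s = s} (inj₁ s≡) (inj₂ (i+1≡m , _)) = ⊥-elim (n≮n _ (subst (_< _) (trans s≡ i+1≡m) (toℕ<n s)))
successor-unique {s′ = s′} (inj₂ (i+1≡m , _)) (inj₁ s′≡) = ⊥-elim (n≮n _ (subst (_< _) (trans s′≡ i+1≡m) (toℕ<n s′)))
successor-unique (inj₂ (_ , s≡0)) (inj₂ (_ , s′≡0)) = toℕ-injective (trans s≡0 (sym s′≡0))

predecessor-unique : {i p p′ : Fin m} → CycSucc m p i → CycSucc m p′ i → p ≡ p′
predecessor-unique (inj₁ i≡) (inj₁ i≡′) = toℕ-injective (suc-injective (trans (sym i≡) i≡′))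
predecessor-unique (inj₁ i≡) (inj₂ (_ , i≡0)) = ⊥-elim (1+n≢0 (trans (sym i≡) i≡0))
predecessor-unique (inj₂ (_ , i≡0)) (inj₁ i≡′) = ⊥-elim (1+n≢0 (trans (sym i≡′) i≡0))
predecessor-unique (inj₂ (p+1≡m , _)) (inj₂ (p′+1≡m , _)) = toℕ-injective (suc-injective (trans p+1≡m (sym p′+1≡m)))

next-adjacent : (i : Fin m) → WAdj m (suc i) (suc (next i))
next-adjacent i = inj₁ (proj₂ (successor i))

prev-adjacent : (i : Fin m) → WAdj m (suc i) (suc (prev i))
prev-adjacent i = inj₂ (proj₂ (predecessor i))

rim-neighbours : (i t : Fin m) → WAdj m (suc i) (suc t) → t ≡ next i ⊎ t ≡ prev i
rim-neighbours i t (inj₁ i→t) = inj₁ (successor-unique i→t (proj₂ (successor i)))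
rim-neighbours i t (inj₂ t→i) = inj₂ (predecessor-unique t→i (proj₂ (predecessor i)))

-- On a cycle of length at least 3 there are no loops and no 2-cycles,
-- so a rim vertex, its successor and its predecessor are pairwise distinct.
3≤m⇒m≢1 : 3 ≤ m → m ≢ 1
3≤m⇒m≢1 (s≤s (s≤s _)) ()

3≤m⇒m≢2 : 3 ≤ m → m ≢ 2
3≤m⇒m≢2 (s≤s (s≤s (s≤s _))) ()

no-loop : {i : Fin m} → 3 ≤ m → ¬ CycSucc m i i
no-loop 3≤m (inj₁ i≡i+1) = 1+n≢n (sym i≡i+1)
no-loop 3≤m (inj₂ (i+1≡m , i≡0)) = 3≤m⇒m≢1 3≤m (trans (sym i+1≡m) (cong suc i≡0))

no-2-cycle : {i s : Fin m} → 3 ≤ m → CycSucc m i s → ¬ CycSucc m s i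
no-2-cycle {i = i} 3≤m (inj₁ s≡i+1) (inj₁ i≡s+1) = n≢2+n (trans i≡s+1 (cong suc s≡i+1))
  where
  n≢2+n : ∀ {n} → n ≢ suc (suc n)
  n≢2+n {zero} ()
  n≢2+n {suc n} e = n≢2+n (suc-injective e)
no-2-cycle 3≤m (inj₁ s≡i+1) (inj₂ (s+1≡m , i≡0)) =
  3≤m⇒m≢2 3≤m (trans (sym s+1≡m) (cong suc (trans s≡i+1 (cong suc i≡0))))
no-2-cycle 3≤m (inj₂ (i+1≡m , s≡0)) (inj₁ i≡s+1) =
  3≤m⇒m≢2 3≤m (trans (sym i+1≡m) (cong suc (trans i≡s+1 (cong suc s≡0))))
no-2-cycle 3≤m (inj₂ (i+1≡m , s≡0)) (inj₂ (_ , i≡0)) =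
  3≤m⇒m≢1 3≤m (trans (sym i+1≡m) (cong suc i≡0))

next≢self : 3 ≤ m → (i : Fin m) → i ≢ next i
next≢self 3≤m i i≡next = no-loop 3≤m (subst (CycSucc _ i) (sym i≡next) (proj₂ (successor i)))

prev≢self : 3 ≤ m → (i : Fin m) → i ≢ prev i
prev≢self 3≤m i i≡prev = no-loop 3≤m (subst (λ p → CycSucc _ p i) (sym i≡prev) (proj₂ (predecessor i)))

next≢prev : 3 ≤ m → (i : Fin m) → next i ≢ prev i
next≢prev 3≤m i next≡prev =
  no-2-cycle 3≤m (proj₂ (successor i)) (subst (λ p → CycSucc _ p i) (sym next≡prev) (proj₂ (predecessor i)))

-- How many vertices can separate a given pair

-- A separator of two rim vertices is a rim neighbour of one of them: at most 4 vertices.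
rim-pair-separators : (i j : Fin m) (S : Subset (suc m)) → suc i ∉ S → suc j ∉ S →
  (∀ {τ} → τ ∈ S → Separates m τ (suc i) (suc j)) → ∣ S ∣ ≤ 4
rim-pair-separators {m} i j S i∉S j∉S sep =
  ⊆list⇒∣∣≤length S (suc (next i) ∷ suc (prev i) ∷ suc (next j) ∷ suc (prev j) ∷ []) neighbour
  where
  neighbour : ∀ {τ} → τ ∈ S → τ ∈ˡ suc (next i) ∷ suc (prev i) ∷ suc (next j) ∷ suc (prev j) ∷ []
  neighbour {τ} τ∈S with τ | separates⇒adjacentToOne (∉⇒≢ i∉S τ∈S) (∉⇒≢ j∉S τ∈S) (sep τ∈S)
  ... | zero | inj₁ (_ , j≁hub) = ⊥-elim (j≁hub tt)
  ... | zero | inj₂ (i≁hub , _) = ⊥-elim (i≁hub tt)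
  ... | suc t | inj₁ (i~t , _) with rim-neighbours i t i~t
  ...   | inj₁ refl = Any.here refl
  ...   | inj₂ refl = Any.there (Any.here refl)
  neighbour {τ} τ∈S | suc t | inj₂ (_ , j~t) with rim-neighbours j t j~t
  ...   | inj₁ refl = Any.there (Any.there (Any.here refl))
  ...   | inj₂ refl = Any.there (Any.there (Any.there (Any.here refl)))

-- A separator of the hub and a rim vertex c is a rim vertex not adjacent to c, so it
-- avoids the four distinct vertices h, c, next c, prev c: at most n − 4 vertices.
hub-rim-separators : 3 ≤ m → (c : Fin m) (S : Subset (suc m)) → zero ∉ S → suc c ∉ S →
  (∀ {τ} → τ ∈ S → Separates m τ zero (suc c)) → ∣ S ∣ + 4 ≤ suc m
hub-rim-separators {m} 3≤m c S hub∉S c∉S sep =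
  avoiding-distinct S (zero ∷ suc c ∷ suc (next c) ∷ suc (prev c) ∷ [])
    distinct (hub∉S ∷ c∉S ∷ not-adjacent-to-c (next-adjacent c) ∷ not-adjacent-to-c (prev-adjacent c) ∷ [])
  where
  not-adjacent-to-c : ∀ {t} → WAdj m (suc c) (suc t) → suc t ∉ S
  not-adjacent-to-c c~t t∈S with separates⇒adjacentToOne (∉⇒≢ hub∉S t∈S) (∉⇒≢ c∉S t∈S) (sep t∈S)
  ... | inj₁ (_ , c≁t) = c≁t c~t
  ... | inj₂ (hub≁t , _) = hub≁t tt
  distinct : Unique (zero ∷ suc c ∷ suc (next c) ∷ suc (prev c) ∷ [])
  distinct = ((λ ()) ∷ (λ ()) ∷ (λ ()) ∷ [])
           ∷ (next≢self 3≤m c ∘ Fin-suc-injective ∷ prev≢self 3≤m c ∘ Fin-suc-injective ∷ [])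
           ∷ (next≢prev 3≤m c ∘ Fin-suc-injective ∷ [])
           ∷ [] ∷ []

-- Lower bounds for an NL-landmark set L with k ≥ 5

module LowerBound (5≤k : 5 ≤ k) (L : Subset (suc m)) (landmark : IsNLLandmark m k L) where

  -- Two rim vertices have fewer than k separators, so at most one of them is outside L.
  rim-outsider-unique : {i j : Fin m} → suc i ∉ L → suc j ∉ L → i ≡ j
  rim-outsider-unique {i} {j} i∉L j∉L with i ≟ᶠ j
  ... | yes i≡j = i≡j
  ... | no i≢j with landmark (suc i) (suc j) (i≢j ∘ Fin-suc-injective) i∉L j∉L
  ...   | S , S⊆L , k≤∣S∣ , sep =
    ⊥-elim (n≮n 4 (≤-trans 5≤k (≤-trans k≤∣S∣ (rim-pair-separators i j S (i∉L ∘ S⊆L) (j∉L ∘ S⊆L) sep))))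

  -- When n ≤ k + 3 the hub and a rim vertex have fewer than k separators.
  hub-and-rim-not-both-outside : 3 ≤ m → suc m ≤ k + 3 → {c : Fin m} → suc c ∉ L → ¬ zero ∉ L
  hub-and-rim-not-both-outside 3≤m n≤k+3 {c} c∉L hub∉L with landmark zero (suc c) (λ ()) hub∉L c∉L
  ... | S , S⊆L , k≤∣S∣ , sep = n≮n 3 (+-cancelˡ-≤ k 4 3 (begin
    k + 4       ≤⟨ +-monoˡ-≤ 4 k≤∣S∣ ⟩
    ∣ S ∣ + 4   ≤⟨ hub-rim-separators 3≤m c S (hub∉L ∘ S⊆L) (c∉L ∘ S⊆L) sep ⟩
    suc m       ≤⟨ n≤k+3 ⟩
    k + 3       ∎))

  some-rim-outside? : Dec (∃ λ c → suc c ∉ L)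
  some-rim-outside? = any? (λ c → ¬? (suc c ∈? L))

  rim-inside⇒all-but-one : ¬ (∃ λ c → suc c ∉ L) → m ≤ ∣ L ∣
  rim-inside⇒all-but-one rim⊆L = ≤-pred (outside⊆list⇒bound L (zero ∷ []) only-hub)
    where
    only-hub : ∀ {x} → x ∉ L → x ∈ˡ zero ∷ []
    only-hub {zero} _ = Any.here refl
    only-hub {suc t} t∉L = ⊥-elim (rim⊆L (t , t∉L))

  -- Outside L lie at most the hub and one rim vertex: |L| ≥ n − 2.
  at-least-all-but-two : m ∸ 1 ≤ ∣ L ∣
  at-least-all-but-two with some-rim-outside?
  ... | no rim⊆L = ≤-trans (m∸n≤m m 1) (rim-inside⇒all-but-one rim⊆L)
  ... | yes (c , c∉L) = ∸-monoˡ-≤ 1 (≤-pred (outside⊆list⇒bound L (zero ∷ suc c ∷ []) hub-or-c))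
    where
    hub-or-c : ∀ {x} → x ∉ L → x ∈ˡ zero ∷ suc c ∷ []
    hub-or-c {zero} _ = Any.here refl
    hub-or-c {suc t} t∉L rewrite rim-outsider-unique t∉L c∉L = Any.there (Any.here refl)

  -- If n ≤ k + 3, at most one vertex lies outside L: |L| ≥ n − 1.
  at-least-all-but-one : 3 ≤ m → suc m ≤ k + 3 → m ≤ ∣ L ∣
  at-least-all-but-one 3≤m n≤k+3 with some-rim-outside?
  ... | no rim⊆L = rim-inside⇒all-but-one rim⊆L
  ... | yes (c , c∉L) = ≤-pred (outside⊆list⇒bound L (suc c ∷ []) only-c)
    where
    only-c : ∀ {x} → x ∉ L → x ∈ˡ suc c ∷ []
    only-c {zero} hub∉L = ⊥-elim (hub-and-rim-not-both-outside 3≤m n≤k+3 c∉L hub∉L)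
    only-c {suc t} t∉L rewrite rim-outsider-unique t∉L c∉L = Any.here refl

-- Constructions

-- The rim is an NL-landmark set for every k: only the hub lies outside it.
rim-landmark : (m k : ℕ) → IsNLLandmark m k (outside ∷ Full)
rim-landmark m k zero zero u≢v _ _ = ⊥-elim (u≢v refl)
rim-landmark m k (suc _) _ _ u∉L _ = ⊥-elim (u∉L (there ∈⊤))
rim-landmark m k zero (suc _) _ _ v∉L = ⊥-elim (v∉L (there ∈⊤))

initial : (r : ℕ) → Subset (suc r)
initial zero = outside ∷ []
initial (suc r) = inside ∷ initial r

∣initial∣ : (r : ℕ) → ∣ initial r ∣ ≡ r
∣initial∣ zero = refl
∣initial∣ (suc r) = cong suc (∣initial∣ r)

initial-< : {x : Fin (suc r)} → x ∈ initial r → toℕ x < r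
initial-< {suc r} here = s≤s z≤n
initial-< {suc r} (there x∈) = s≤s (initial-< x∈)
initial-< {zero} (there ())

-- On the rim c₁ … c_{3+r} (vertex suc i is c_{i+1}): the rim vertices c₃ … c_{r+2},
-- i.e. all rim vertices other than c₁ and its two neighbours c₂ and c_{3+r}.
far-from-first : (r : ℕ) → Subset (suc (3 + r))
far-from-first r = outside ∷ outside ∷ outside ∷ initial r

far-not-adjacent : {x : Fin (suc r)} → x ∈ initial r → ¬ WAdj (3 + r) (suc zero) (suc (suc (suc x)))
far-not-adjacent x∈ (inj₁ (inj₁ ()))
far-not-adjacent x∈ (inj₁ (inj₂ (() , _)))
far-not-adjacent x∈ (inj₂ (inj₁ ()))
far-not-adjacent {r} x∈ (inj₂ (inj₂ (x+3≡r+3 , _))) =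
  n≮n r (subst (_< r) (suc-injective (suc-injective (suc-injective x+3≡r+3))) (initial-< x∈))

-- Each far rim vertex is adjacent to the hub but not to c₁, hence separates them.
far-separates : {τ : Fin (suc (3 + r))} → τ ∈ far-from-first r → Separates (3 + r) τ zero (suc zero)
far-separates {τ = suc (suc (suc _))} (there (there (there x∈))) =
  adjacentToOne⇒separates (λ ()) (λ ()) (inj₁ (tt , far-not-adjacent x∈))

-- Removing c₁ from the rim leaves an NL-landmark set as long as k ≤ r: the only pair
-- outside it is {h, c₁}, separated by the r far rim vertices.
rim-but-first-landmark : (r k : ℕ) → k ≤ r → IsNLLandmark (3 + r) k (outside ∷ outside ∷ Full)
rim-but-first-landmark r k k≤r = landmark
  where
  far⊆L : far-from-first r ⊆ outside ∷ outside ∷ Full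
  far⊆L {suc (suc (suc _))} (there (there (there _))) = there (there ∈⊤)
  k≤∣far∣ : k ≤ ∣ far-from-first r ∣
  k≤∣far∣ = subst (k ≤_) (sym (∣initial∣ r)) k≤r
  landmark : IsNLLandmark (3 + r) k (outside ∷ outside ∷ Full)
  landmark zero zero u≢v _ _ = ⊥-elim (u≢v refl)
  landmark zero (suc zero) _ _ _ = far-from-first r , far⊆L , k≤∣far∣ , far-separates
  landmark (suc zero) zero _ _ _ = far-from-first r , far⊆L , k≤∣far∣ , separates-sym ∘ far-separates
  landmark (suc zero) (suc zero) u≢v _ _ = ⊥-elim (u≢v refl)
  landmark (suc (suc _)) _ _ u∉L _ = ⊥-elim (u∉L (there (there ∈⊤)))
  landmark zero (suc (suc _)) _ _ v∉L = ⊥-elim (v∉L (there (there ∈⊤)))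
  landmark (suc zero) (suc (suc _)) _ _ v∉L = ⊥-elim (v∉L (there (there ∈⊤)))

mainTheorem14 : (n k : ℕ) → 6 ≤ n → 5 ≤ k →
    (k + 4 ≤ n → IsMdNL (n ∸ 1) k (n ∸ 2)) ×
    (n ≤ k + 3 → IsMdNL (n ∸ 1) k (n ∸ 1))
mainTheorem14 (suc (suc (suc (suc r)))) k (s≤s (s≤s (s≤s (s≤s _)))) 5≤k =
    (λ k+4≤n → (outside ∷ outside ∷ Full , rim-but-first-landmark r k (k≤r k+4≤n) , ∣⊤∣≡n (2 + r))
             , λ L isLandmark → LowerBound.at-least-all-but-two 5≤k L isLandmark)
  , (λ n≤k+3 → (outside ∷ Full , rim-landmark (3 + r) k , ∣⊤∣≡n (3 + r))
             , λ L isLandmark → LowerBound.at-least-all-but-one 5≤k L isLandmark (m≤m+n 3 r) n≤k+3)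
  where
  k≤r : k + 4 ≤ 4 + r → k ≤ r
  k≤r k+4≤4+r = +-cancelʳ-≤ 4 k r (subst (k + 4 ≤_) (+-comm 4 r) k+4≤4+r)
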